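{- Let $s\in\mathbb N$. For $x,y\in[0,1)$ define $$\chi^{(s)}([0,y),x)=\frac12-\frac12\sum_{a=1}^s\chi(\Pi_a,x^{(s)}\oplus y^{(s)})\,r_a(y),\qquad \varepsilon^{(s)}(x,y)=\chi([0,y),x)-\chi^{(s)}([0,y),x).$$ Then for all $x,y\in[0,1)$, $$0\le\chi^{(s)}([0,y),x)\le1\quad\text{and}\quad |\varepsilon^{(s)}(x,y)|\le\tfrac12\,\delta^{(s)}(x,y).$$
   Context: $\chi(\mathcal E,\cdot)$ denotes the characteristic function of a set $\mathcal E$. Every $y\in[0,1)$ has a unique dyadic expansion $y=\sum_{a\ge1}\eta_a(y)2^{ -a}$, $\eta_a(y)\in\{0,1\}$, with infinitely many zero digits. $r_a(y)=(-1)^{\eta_a(y)}$ for $a\ge1$. The projection is $y^{(s)}=\sum_{a=1}^s\eta_a(y)2^{ -a}$. For points $u,v$ of $\mathbb Q(2^s)=\{m2^{ -s}:0\le m\le2^s-1\}$, $u\oplus v$ is defined by $\eta_a(u\oplus v)=\eta_a(u)+\eta_a(v)\bmod2$. $\Pi_a=[2^{ -a},2^{1-a})$ for $a\in\mathbb N$. $\delta^{(s)}(x,y)=1$ if $x^{(s)}=y^{(s)}$ and $0$ otherwise. -}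

module Defs where

open import Data.Bool using (Bool; true; false; if_then_else_; _xor_; _∧_; not)
open import Data.Nat using (ℕ; zero; suc; _<_)
open import Data.Product using (Σ; _×_)
open import Data.Sum using (_⊎_)
open import Data.Rational using (ℚ; 0ℚ; 1ℚ; ½; _+_; _*_; _-_; -_; _≤ᵇ_)
open import Data.Rational.Properties using (_≟_)
open import Relation.Nullary using (¬_; does)
open import Relation.Binary.PropositionalEquality using (_≡_)

-- A point y ∈ [0,1) is given by its dyadic digit sequence:
-- η a = η_a(y) for a ≥ 1 (the value at index 0 is never used).
Digits : Set
Digits = ℕ → Bool

InfZeros : Digits → Set
InfZeros η = ∀ n → Σ ℕ λ m → (n < m) × (η m ≡ false)

sumTo : ℕ → (ℕ → ℚ) → ℚ
sumTo zero    f = 0ℚ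
sumTo (suc s) f = sumTo s f + f (suc s)

half^ : ℕ → ℚ
half^ zero    = 1ℚ
half^ (suc a) = ½ * half^ a

bit : Bool → ℚ
bit true  = 1ℚ
bit false = 0ℚ

proj : ℕ → Digits → ℚ
proj s η = sumTo s (λ a → bit (η a) * half^ a)

oplusProj : ℕ → Digits → Digits → ℚ
oplusProj s x y = proj s (λ a → x a xor y a)

r : ℕ → Digits → ℚ
r a y = if y a then - 1ℚ else 1ℚ

χΠ : ℕ → ℚ → ℚ
χΠ a z = if (half^ a ≤ᵇ z) ∧ not ((1ℚ + 1ℚ) * half^ a ≤ᵇ z) then 1ℚ else 0ℚ

χs : ℕ → Digits → Digits → ℚ
χs s x y = ½ - ½ * sumTo s (λ a → χΠ a (oplusProj s x y) * r a y)

δs : ℕ → Digits → Digits → ℚ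
δs s x y = if does (proj s x ≟ proj s y) then 1ℚ else 0ℚ

-- x < y for points of [0,1) given by digit sequences with infinitely many
-- zeros: at the first index a ≥ 1 where the digits differ, η_a(x)=0, η_a(y)=1.
_<ᵈ_ : Digits → Digits → Set
x <ᵈ y = Σ ℕ λ a → (0 < a) × (∀ b → 0 < b → b < a → x b ≡ y b)
                     × (x a ≡ false) × (y a ≡ true)

-- c is the value χ([0,y),x) (i.e. 1 if x ∈ [0,y), 0 otherwise)
IsχInterval : Digits → Digits → ℚ → Set
IsχInterval y x c = ((x <ᵈ y) × (c ≡ 1ℚ)) ⊎ ((¬ (x <ᵈ y)) × (c ≡ 0ℚ))

module Submission where

-- Let z = x^{(s)} ⊕ y^{(s)}; its digits are the digits of x xor y.
--   * If x and y agree on the digits 1..s, then z = 0 lies in no Π_a, the Walsh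
--     sum vanishes and χ^{(s)}([0,y),x) = ½; moreover x^{(s)} = y^{(s)}, so
--     δ^{(s)}(x,y) = 1, and |c − ½| ≤ ½ for both values c ∈ {0,1} of χ([0,y),x).
--   * If the first differing digit is k ≤ s, then z has zero digits before k
--     and digit k equal to one, hence 2^{-k} ≤ z < 2^{1-k}: z lies in Π_k and
--     in no other Π_a. The Walsh sum collapses to r_k(y), so χ^{(s)} equals
--     ½ − ½ r_k(y), which is 1 when η_k(y) = 1 (then x < y) and 0 when
--     η_k(y) = 0 (then y < x): the error ε^{(s)} vanishes.
-- The file develops, in order: the dyadic scale 2^{-a}; finite sums; the window
-- bound for truncated dyadic expansions, which locates z among the Π_a; the
-- collapse of the Walsh sum; the first-difference dichotomy for digit
-- sequences and what it says about χ^{(s)} and χ([0,y),x). Digit positions are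
-- written suc j (so k = j + 1), which keeps every index at least one.

open import Defs
open import Data.Nat using (ℕ)
open import Data.Product using (_×_)
open import Data.Rational using (ℚ; 0ℚ; 1ℚ; ½; _*_; _-_; ∣_∣; _≤_)

open import Data.Nat as ℕ using (zero; suc; s≤s; z≤n; _≤′_; ≤′-refl; ≤′-step)
import Data.Nat.Properties as ℕ
open import Data.Rational using (_+_; -_; _<_; _≤ᵇ_)
open import Data.Rational.Properties
  using ( ≤-refl; ≤-trans; ≤-reflexive; <⇒≤; <-irrefl; <-≤-trans; ≤ᵇ⇒≤; ≤⇒≤ᵇ
        ; positive⁻¹; *-monoʳ-<-pos; +-monoʳ-≤; +-monoˡ-≤; +-monoʳ-<
        ; +-identityˡ; +-identityʳ; +-assoc; *-assoc; *-identityˡ; *-zeroˡ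
        ; *-distribʳ-+; _≟_ )
open import Data.Bool using (true; false; not; _xor_; _∧_; if_then_else_)
open import Data.Bool.Properties
  using (T-≡; ¬-not; xor-same; not-distribˡ-xor; ∧-zeroʳ)
  renaming (_≟_ to _≟ᵇ_)
open import Data.Product using (Σ; _,_; proj₁; proj₂)
open import Data.Sum using (_⊎_; inj₁; inj₂)
open import Data.Empty using (⊥-elim)
open import Function.Bundles using (Equivalence)
open import Relation.Nullary using (¬_; does; yes; no; contradiction)
open import Relation.Binary using (tri<; tri≈; tri>)
open import Relation.Binary.PropositionalEquality
  using (_≡_; _≢_; refl; sym; trans; cong; cong₂; subst)

≤ᵇ-true : ∀ {p q} → p ≤ q → (p ≤ᵇ q) ≡ true
≤ᵇ-true p≤q = Equivalence.to T-≡ (≤⇒≤ᵇ p≤q)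

≤ᵇ-false : ∀ {p q} → q < p → (p ≤ᵇ q) ≡ false
≤ᵇ-false q<p = ¬-not λ p≤ᵇq → <-irrefl refl (<-≤-trans q<p (≤ᵇ⇒≤ (Equivalence.from T-≡ p≤ᵇq)))

≤-+-nonneg : ∀ p {q} → 0ℚ ≤ q → p ≤ p + q
≤-+-nonneg p 0≤q = subst (_≤ p + _) (+-identityʳ p) (+-monoʳ-≤ p 0≤q)

half^-pos : ∀ a → 0ℚ < half^ a
half^-pos zero    = positive⁻¹ 1ℚ
half^-pos (suc a) = *-monoʳ-<-pos ½ (half^-pos a)

half^-nonneg : ∀ a → 0ℚ ≤ half^ a
half^-nonneg a = <⇒≤ (half^-pos a)

double-half^ : ∀ a → (1ℚ + 1ℚ) * half^ (suc a) ≡ half^ a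
double-half^ a = trans (sym (*-assoc (1ℚ + 1ℚ) ½ (half^ a))) (*-identityˡ (half^ a))

half^-split : ∀ a → half^ (suc a) + half^ (suc a) ≡ half^ a
half^-split a = trans (sym doubling) (double-half^ a)
  where
  doubling : (1ℚ + 1ℚ) * half^ (suc a) ≡ half^ (suc a) + half^ (suc a)
  doubling = trans (*-distribʳ-+ (half^ (suc a)) 1ℚ 1ℚ)
                   (cong₂ _+_ (*-identityˡ (half^ (suc a))) (*-identityˡ (half^ (suc a))))

half^-antitone : ∀ {a b} → a ≤′ b → half^ b ≤ half^ a
half^-antitone ≤′-refl               = ≤-refl
half^-antitone {a} (≤′-step {b} a≤b) =
  ≤-trans (subst (half^ (suc b) ≤_) (half^-split b) (≤-+-nonneg _ (half^-nonneg (suc b))))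
          (half^-antitone a≤b)

sumTo-cong : ∀ s {f g : ℕ → ℚ} → (∀ i → i ℕ.< s → f (suc i) ≡ g (suc i)) →
             sumTo s f ≡ sumTo s g
sumTo-cong zero    eq = refl
sumTo-cong (suc s) eq =
  cong₂ _+_ (sumTo-cong s λ i i<s → eq i (ℕ.m<n⇒m<1+n i<s)) (eq s (ℕ.n<1+n s))

sumTo-zero : ∀ s {f : ℕ → ℚ} → (∀ i → i ℕ.< s → f (suc i) ≡ 0ℚ) → sumTo s f ≡ 0ℚ
sumTo-zero zero    vanish = refl
sumTo-zero (suc s) vanish =
  cong₂ _+_ (sumTo-zero s λ i i<s → vanish i (ℕ.m<n⇒m<1+n i<s)) (vanish s (ℕ.n<1+n s))

sumTo-single : ∀ s {j} {f : ℕ → ℚ} → j ℕ.< s →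
               (∀ i → i ℕ.< s → i ≢ j → f (suc i) ≡ 0ℚ) → sumTo s f ≡ f (suc j)
sumTo-single (suc s) {j} {f} j<1+s vanish with ℕ.m<1+n⇒m<n∨m≡n j<1+s
... | inj₂ refl = trans (cong (_+ f (suc s)) (sumTo-zero s others)) (+-identityˡ _)
  where
  others : ∀ i → i ℕ.< s → f (suc i) ≡ 0ℚ
  others i i<s = vanish i (ℕ.m<n⇒m<1+n i<s) (ℕ.<⇒≢ i<s)
... | inj₁ j<s =
  trans (cong₂ _+_ (sumTo-single s j<s λ i i<s → vanish i (ℕ.m<n⇒m<1+n i<s))
                   (vanish s (ℕ.n<1+n s) (ℕ.>⇒≢ j<s)))
        (+-identityʳ _)

-- For the truncated expansion y^{(m)} = Σ_{a=1}^m η_a 2^{-a}: appending digit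
-- m+1 raises y^{(m)} by at most 2^{-(m+1)}, so the window
-- [y^{(m)}, y^{(m)} + 2^{-m}] can only shrink as m grows.
proj-step : ∀ m (d : Digits) →
  (proj m d ≤ proj (suc m) d) × (proj (suc m) d + half^ (suc m) ≤ proj m d + half^ m)
proj-step m d = ≤-+-nonneg (proj m d) (digit-nonneg (d (suc m))) , shrink
  where
  h = half^ (suc m)

  digit-nonneg : ∀ b → 0ℚ ≤ bit b * h
  digit-nonneg true  = subst (0ℚ ≤_) (sym (*-identityˡ h)) (half^-nonneg (suc m))
  digit-nonneg false = subst (0ℚ ≤_) (sym (*-zeroˡ h)) ≤-refl

  digit-≤ : ∀ b → bit b * h ≤ h
  digit-≤ true  = ≤-reflexive (*-identityˡ h)
  digit-≤ false = subst (_≤ h) (sym (*-zeroˡ h)) (half^-nonneg (suc m))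

  shrink : (proj m d + bit (d (suc m)) * h) + h ≤ proj m d + half^ m
  shrink = ≤-trans (+-monoˡ-≤ h (+-monoʳ-≤ (proj m d) (digit-≤ (d (suc m)))))
                   (≤-reflexive (trans (+-assoc (proj m d) h h) (cong (proj m d +_) (half^-split m))))

proj-window : ∀ {k m} (d : Digits) → k ≤′ m →
  (proj k d ≤ proj m d) × (proj m d + half^ m ≤ proj k d + half^ k)
proj-window d ≤′-refl               = ≤-refl , ≤-refl
proj-window d (≤′-step {m} k≤m) with proj-window d k≤m | proj-step m d
... | low , high | low′ , high′ = ≤-trans low low′ , ≤-trans high′ high

ZerosUpTo : ℕ → Digits → Set
ZerosUpTo n d = ∀ i → i ℕ.< n → d (suc i) ≡ false

LeadingOne : ℕ → Digits → Set
LeadingOne j d = ZerosUpTo j d × d (suc j) ≡ true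

proj-zeros : ∀ {n} {d : Digits} → ZerosUpTo n d → proj n d ≡ 0ℚ
proj-zeros {n} {d} zeros =
  sumTo-zero n λ i i<n → trans (cong (λ b → bit b * half^ (suc i)) (zeros i i<n)) (*-zeroˡ (half^ (suc i)))

proj-leadingOne : ∀ {j} {d : Digits} → LeadingOne j d → proj (suc j) d ≡ half^ (suc j)
proj-leadingOne {j} {d} (zeros , one) =
  trans (cong₂ _+_ (proj-zeros {j} {d} zeros) (cong (λ b → bit b * half^ (suc j)) one))
        (trans (+-identityˡ (1ℚ * half^ (suc j))) (*-identityˡ (half^ (suc j))))

proj-location : ∀ {j s} {d : Digits} → LeadingOne j d → j ℕ.< s →
  (half^ (suc j) ≤ proj s d) × (proj s d < half^ j)
proj-location {j} {s} {d} lead j<s = lower , upper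
  where
  window : (proj (suc j) d ≤ proj s d) × (proj s d + half^ s ≤ proj (suc j) d + half^ (suc j))
  window = proj-window d (ℕ.≤⇒≤′ j<s)
  lower : half^ (suc j) ≤ proj s d
  lower = subst (_≤ proj s d) (proj-leadingOne {j} {d} lead) (proj₁ window)
  upper : proj s d < half^ j
  upper = <-≤-trans below-window (subst (proj s d + half^ s ≤_) window-end (proj₂ window))
    where
    below-window : proj s d < proj s d + half^ s
    below-window = subst (_< proj s d + half^ s) (+-identityʳ (proj s d))
                         (+-monoʳ-< (proj s d) (half^-pos s))
    window-end : proj (suc j) d + half^ (suc j) ≡ half^ j
    window-end = trans (cong (_+ half^ (suc j)) (proj-leadingOne {j} {d} lead)) (half^-split j)

χΠ-suc : ∀ i z → χΠ (suc i) z ≡ (if (half^ (suc i) ≤ᵇ z) ∧ not (half^ i ≤ᵇ z) then 1ℚ else 0ℚ)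
χΠ-suc i z = cong (λ e → if (half^ (suc i) ≤ᵇ z) ∧ not (e ≤ᵇ z) then 1ℚ else 0ℚ) (double-half^ i)

χΠ-in : ∀ {j z} → half^ (suc j) ≤ z → z < half^ j → χΠ (suc j) z ≡ 1ℚ
χΠ-in {j} {z} lo hi rewrite χΠ-suc j z | ≤ᵇ-true lo | ≤ᵇ-false hi = refl

χΠ-left : ∀ {i z} → z < half^ (suc i) → χΠ (suc i) z ≡ 0ℚ
χΠ-left {i} {z} lt rewrite χΠ-suc i z | ≤ᵇ-false lt = refl

χΠ-right : ∀ {i z} → half^ i ≤ z → χΠ (suc i) z ≡ 0ℚ
χΠ-right {i} {z} le rewrite χΠ-suc i z | ≤ᵇ-true le | ∧-zeroʳ (half^ (suc i) ≤ᵇ z) = refl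

χΠ-disjoint : ∀ {j z} → half^ (suc j) ≤ z → z < half^ j → ∀ i → i ≢ j → χΠ (suc i) z ≡ 0ℚ
χΠ-disjoint {j} {z} lo hi i i≢j with ℕ.<-cmp i j
... | tri< i<j _ _ = χΠ-left {i} {z} (<-≤-trans hi (half^-antitone (ℕ.≤⇒≤′ i<j)))
... | tri≈ _ i≡j _ = ⊥-elim (i≢j i≡j)
... | tri> _ _ j<i = χΠ-right {i} {z} (≤-trans (half^-antitone (ℕ.≤⇒≤′ j<i)) lo)

walsh-collapse : ∀ {j s z} (g : ℕ → ℚ) → j ℕ.< s → half^ (suc j) ≤ z → z < half^ j →
  sumTo s (λ a → χΠ a z * g a) ≡ g (suc j)
walsh-collapse {j} {s} g j<s lo hi =
  trans (sumTo-single s j<s λ i _ i≢j →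
           trans (cong (_* g (suc i)) (χΠ-disjoint {j} lo hi i i≢j)) (*-zeroˡ (g (suc i))))
        (trans (cong (_* g (suc j)) (χΠ-in {j} lo hi)) (*-identityˡ (g (suc j))))

walsh-zero : ∀ s (g : ℕ → ℚ) → sumTo s (λ a → χΠ a 0ℚ * g a) ≡ 0ℚ
walsh-zero s g = sumTo-zero s λ i _ →
  trans (cong (_* g (suc i)) (χΠ-left {i} (half^-pos (suc i)))) (*-zeroˡ (g (suc i)))

AgreeUpTo : ℕ → Digits → Digits → Set
AgreeUpTo n x y = ∀ i → i ℕ.< n → x (suc i) ≡ y (suc i)

FirstDiff : ℕ → Digits → Digits → Set
FirstDiff j x y = AgreeUpTo j x y × x (suc j) ≢ y (suc j)

agree-or-differ : ∀ s (x y : Digits) →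
  AgreeUpTo s x y ⊎ Σ ℕ (λ j → j ℕ.< s × FirstDiff j x y)
agree-or-differ zero    x y = inj₁ λ i ()
agree-or-differ (suc s) x y with agree-or-differ s x y
... | inj₂ (j , j<s , first) = inj₂ (j , ℕ.m<n⇒m<1+n j<s , first)
... | inj₁ agree with x (suc s) ≟ᵇ y (suc s)
...   | no  differ = inj₂ (s , ℕ.n<1+n s , agree , differ)
...   | yes same   = inj₁ extended
  where
  extended : AgreeUpTo (suc s) x y
  extended i i<1+s with ℕ.m<1+n⇒m<n∨m≡n i<1+s
  ... | inj₁ i<s  = agree i i<s
  ... | inj₂ refl = same

_⊕_ : Digits → Digits → Digits
(x ⊕ y) a = x a xor y a

xor-distinct : ∀ {b c} → b ≢ c → b xor c ≡ true
xor-distinct {b} {c} b≢c =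
  trans (cong (_xor c) (¬-not b≢c))
        (trans (sym (not-distribˡ-xor c c)) (cong not (xor-same c)))

agree⇒zeros : ∀ {n} {x y : Digits} → AgreeUpTo n x y → ZerosUpTo n (x ⊕ y)
agree⇒zeros {x = x} {y} agree i i<n =
  trans (cong (_xor y (suc i)) (agree i i<n)) (xor-same (y (suc i)))

firstDiff⇒leadingOne : ∀ {j} {x y : Digits} → FirstDiff j x y → LeadingOne j (x ⊕ y)
firstDiff⇒leadingOne {j} {x} {y} (agree , differ) =
  agree⇒zeros {j} {x} {y} agree , xor-distinct differ

firstDiff-< : ∀ {j} {x y : Digits} → FirstDiff j x y → y (suc j) ≡ true → x <ᵈ y
firstDiff-< {j} {x} {y} (agree , differ) yⱼ≡1 =
  suc j , s≤s z≤n , below , ¬-not (λ xⱼ≡1 → differ (trans xⱼ≡1 (sym yⱼ≡1))) , yⱼ≡1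
  where
  below : ∀ b → 0 ℕ.< b → b ℕ.< suc j → x b ≡ y b
  below (suc i) _ (s≤s i<j) = agree i i<j

firstDiff-≮ : ∀ {j} {x y : Digits} → FirstDiff j x y → y (suc j) ≡ false → ¬ (x <ᵈ y)
firstDiff-≮ {j} {x} {y} (agree , differ) yⱼ≡0 (suc i , _ , below , xᵢ≡0 , yᵢ≡1)
  with ℕ.<-cmp i j
... | tri< i<j _ _ = contradiction (trans (sym xᵢ≡0) (trans (agree i i<j) yᵢ≡1)) λ ()
... | tri≈ _ refl _ = contradiction (trans (sym yⱼ≡0) yᵢ≡1) λ ()
... | tri> _ _ j<i = contradiction (below (suc j) (s≤s z≤n) (s≤s j<i)) differ

χs-agree : ∀ {s} {x y : Digits} → AgreeUpTo s x y → χs s x y ≡ ½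
χs-agree {s} {x} {y} agree =
  trans (cong (λ z → ½ - ½ * sumTo s (λ a → χΠ a z * r a y)) z≡0)
        (cong (λ t → ½ - ½ * t) (walsh-zero s (λ a → r a y)))
  where
  z≡0 : oplusProj s x y ≡ 0ℚ
  z≡0 = proj-zeros {s} {x ⊕ y} (agree⇒zeros {s} {x} {y} agree)

χs-firstDiff : ∀ {j s} {x y : Digits} → FirstDiff j x y → j ℕ.< s →
  χs s x y ≡ ½ - ½ * r (suc j) y
χs-firstDiff {j} {s} {x} {y} first j<s =
  cong (λ t → ½ - ½ * t) (walsh-collapse (λ a → r a y) j<s lo hi)
  where
  location : (half^ (suc j) ≤ oplusProj s x y) × (oplusProj s x y < half^ j)
  location = proj-location {j} {s} {x ⊕ y} (firstDiff⇒leadingOne {j} {x} {y} first) j<s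
  lo = proj₁ location
  hi = proj₂ location

χs-below : ∀ {j s} {x y : Digits} → FirstDiff j x y → j ℕ.< s → y (suc j) ≡ true →
  χs s x y ≡ 1ℚ
χs-below {j} {s} {x} {y} first j<s yⱼ≡1 =
  trans (χs-firstDiff {j} {s} {x} {y} first j<s)
        (cong (λ b → ½ - ½ * (if b then - 1ℚ else 1ℚ)) yⱼ≡1)

χs-above : ∀ {j s} {x y : Digits} → FirstDiff j x y → j ℕ.< s → y (suc j) ≡ false →
  χs s x y ≡ 0ℚ
χs-above {j} {s} {x} {y} first j<s yⱼ≡0 =
  trans (χs-firstDiff {j} {s} {x} {y} first j<s)
        (cong (λ b → ½ - ½ * (if b then - 1ℚ else 1ℚ)) yⱼ≡0)

δs-agree : ∀ {s} {x y : Digits} → AgreeUpTo s x y → δs s x y ≡ 1ℚ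
δs-agree {s} {x} {y} agree with proj s x ≟ proj s y
... | yes _ = refl
... | no  x⁽ˢ⁾≢y⁽ˢ⁾ = contradiction x⁽ˢ⁾≡y⁽ˢ⁾ x⁽ˢ⁾≢y⁽ˢ⁾
  where
  x⁽ˢ⁾≡y⁽ˢ⁾ : proj s x ≡ proj s y
  x⁽ˢ⁾≡y⁽ˢ⁾ = sumTo-cong s λ i i<s → cong (λ b → bit b * half^ (suc i)) (agree i i<s)

½δs-nonneg : ∀ s (x y : Digits) → 0ℚ ≤ ½ * δs s x y
½δs-nonneg s x y with does (proj s x ≟ proj s y)
... | true  = ≤ᵇ⇒≤ _
... | false = ≤ᵇ⇒≤ _

Conclusion : ℕ → Digits → Digits → ℚ → Set
Conclusion s x y t = (0ℚ ≤ t) × (t ≤ 1ℚ) × (∀ c → IsχInterval y x c → ∣ c - t ∣ ≤ ½ * δs s x y)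

conclusion-agree : ∀ {s} {x y : Digits} → AgreeUpTo s x y → Conclusion s x y ½
conclusion-agree {s} {x} {y} agree = ≤ᵇ⇒≤ _ , ≤ᵇ⇒≤ _ , error
  where
  error : ∀ c → IsχInterval y x c → ∣ c - ½ ∣ ≤ ½ * δs s x y
  error c interval rewrite δs-agree {s} {x} {y} agree with interval
  ... | inj₁ (_ , refl) = ≤ᵇ⇒≤ _
  ... | inj₂ (_ , refl) = ≤ᵇ⇒≤ _

conclusion-below : ∀ {s} {x y : Digits} → x <ᵈ y → Conclusion s x y 1ℚ
conclusion-below {s} {x} {y} x<y = ≤ᵇ⇒≤ _ , ≤ᵇ⇒≤ _ , error
  where
  error : ∀ c → IsχInterval y x c → ∣ c - 1ℚ ∣ ≤ ½ * δs s x y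
  error c (inj₁ (_ , refl)) = ½δs-nonneg s x y
  error c (inj₂ (x≮y , _))  = contradiction x<y x≮y

conclusion-above : ∀ {s} {x y : Digits} → ¬ (x <ᵈ y) → Conclusion s x y 0ℚ
conclusion-above {s} {x} {y} x≮y = ≤ᵇ⇒≤ _ , ≤ᵇ⇒≤ _ , error
  where
  error : ∀ c → IsχInterval y x c → ∣ c - 0ℚ ∣ ≤ ½ * δs s x y
  error c (inj₁ (x<y , _)) = contradiction x<y x≮y
  error c (inj₂ (_ , refl)) = ½δs-nonneg s x y

lemma4p1 : (s : ℕ) (x y : Digits) → InfZeros x → InfZeros y →
    (0ℚ ≤ χs s x y) × (χs s x y ≤ 1ℚ) ×
    (∀ c → IsχInterval y x c → ∣ c - χs s x y ∣ ≤ ½ * δs s x y)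
lemma4p1 s x y _ _ with agree-or-differ s x y
... | inj₁ agree =
  subst (Conclusion s x y) (sym (χs-agree {s} {x} {y} agree)) (conclusion-agree {s} {x} {y} agree)
... | inj₂ (j , j<s , first) with y (suc j) ≟ᵇ true
...   | yes yⱼ≡1 = subst (Conclusion s x y) (sym (χs-below {j} {s} {x} {y} first j<s yⱼ≡1))
                         (conclusion-below {s} (firstDiff-< {j} {x} {y} first yⱼ≡1))
...   | no  yⱼ≢1 = subst (Conclusion s x y) (sym (χs-above {j} {s} {x} {y} first j<s yⱼ≡0))
                         (conclusion-above {s} (firstDiff-≮ {j} {x} {y} first yⱼ≡0))
  where
  yⱼ≡0 : y (suc j) ≡ false
  yⱼ≡0 = ¬-not yⱼ≢1
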